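{- Let $\mathcal B$ be a branch of an $\mathsf{OTAB}$ tableau for $\Gamma\vdash_M\Delta$ which is completed but not $T$-closed. Then for every node $u$ on $\mathcal B$, the model $\mathrm{At}(\mathcal B)$ (the assignment making exactly the atoms in $\mathrm{At}(\mathcal B)$ true) satisfies every formula in $A_u$.
   Context: $\mathsf{OTAB}$ (Olivetti's tableau for minimal entailment): nodes carry signed formulas $T\phi$/$F\phi$, marked or unmarked. $\alpha$-type signed formulas (components $\alpha_1,\alpha_2$): $T(A\wedge B)$: $TA,TB$; $F\neg(A\wedge B)$: $F\neg A,F\neg B$; $T\neg(A\vee B)$: $T\neg A,T\neg B$; $F(A\vee B)$: $FA,FB$; $T\neg(A\rightarrow B)$: $TA,T\neg B$; $F(A\rightarrow B)$: $F\neg A,FB$; $T\neg\neg A$: $TA,TA$; $F\neg\neg A$: $FA,FA$. $\beta$-type (components $\beta_1,\beta_2$): $T(A\vee B)$: $TA,TB$; $F\neg(A\vee B)$: $F\neg A,F\neg B$; $T\neg(A\wedge B)$: $T\neg A,T\neg B$; $F(A\wedge B)$: $FA,FB$; $T(A\rightarrow B)$: $T\neg A,TB$; $F\neg(A\rightarrow B)$: $FA,F\neg B$. A tableau for $\Gamma\vdash_M\Delta$ starts with one branch of unmarked $T\gamma$ ($\gamma\in\Gamma$), $F\delta$ ($\delta\in\Delta$) and is extended by: (A) mark an unmarked $\alpha$-type node of branch $\mathcal B$ and append unmarked $\alpha_1,\alpha_2$ to $\mathcal B$; (B) mark an unmarked $\beta$-type node of $\mathcal B$ and split $\mathcal B$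 into a branch extended by unmarked $\beta_1$ and one extended by unmarked $\beta_2$. A branch is completed if all its unmarked formulas are literals; it is $T$-closed if it contains $TA$ and $T\neg A$ for some formula $A$. $\mathrm{At}(\mathcal B)=\{p \text{ atom}: Tp \text{ is a node of }\mathcal B\}$. Annotations $A_u$: all nodes of the initial tableau get $A_u=\Gamma$. When rule (A) is applied to a node $T\chi$ of a branch whose current last node is $u$, with components $T\chi_1,T\chi_2$, the new nodes $v,w$ get $A_v=A_w=(\{\chi_1,\chi_2\}\cup A_u)\setminus\{\chi\}$; when applied to an $F$-formula, $A_v=A_w=A_u$. When rule (B) is applied to $T\chi$ with components $T\chi_1,T\chi_2$, producing new nodes $v$ (labelled $T\chi_1$) and $w$ (labelled $T\chi_2$) below $u$: $A_v=(\{\chi_1\}\cup A_u)\setminus\{\chi\}$, $A_w=(\{\chi_2\}\cup A_u)\setminus\{\chi\}$; when applied to an $F$-formula, $A_v=A_w=A_u$. -}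

module Defs where

open import Data.Nat using (ℕ) renaming (_≡ᵇ_ to _==ℕ_)
open import Data.Bool using (Bool; true; false; _∧_; _∨_; not; if_then_else_)
open import Data.List using (List; []; _∷_; _++_; map; filter)
open import Data.List.Relation.Unary.All using (All)
open import Data.List.Relation.Unary.Any using (Any)
open import Data.Product using (Σ; _×_)
open import Relation.Binary.PropositionalEquality using (_≡_)

data Formula : Set where
  atom : ℕ → Formula
  ¬′_  : Formula → Formula
  _∧′_ : Formula → Formula → Formula
  _∨′_ : Formula → Formula → Formula
  _⇒′_ : Formula → Formula → Formula

_==_ : Formula → Formula → Bool
atom p == atom q = p ==ℕ q
(¬′ a) == (¬′ b) = a == b
(a ∧′ b) == (c ∧′ d) = (a == c) ∧ (b == d)
(a ∨′ b) == (c ∨′ d) = (a == c) ∧ (b == d)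
(a ⇒′ b) == (c ⇒′ d) = (a == c) ∧ (b == d)
_ == _ = false

eval : (ℕ → Bool) → Formula → Bool
eval v (atom p) = v p
eval v (¬′ a) = not (eval v a)
eval v (a ∧′ b) = eval v a ∧ eval v b
eval v (a ∨′ b) = eval v a ∨ eval v b
eval v (a ⇒′ b) = not (eval v a) ∨ eval v b

data Signed : Set where
  T F : Formula → Signed

data Lit : Formula → Set where
  pos : ∀ p → Lit (atom p)
  neg : ∀ p → Lit (¬′ atom p)

Literal : Signed → Set
Literal (T a) = Lit a
Literal (F a) = Lit a

data Alpha : Signed → Signed → Signed → Set where
  tAnd    : ∀ A B → Alpha (T (A ∧′ B)) (T A) (T B)
  fNotAnd : ∀ A B → Alpha (F (¬′ (A ∧′ B))) (F (¬′ A)) (F (¬′ B))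
  tNotOr  : ∀ A B → Alpha (T (¬′ (A ∨′ B))) (T (¬′ A)) (T (¬′ B))
  fOr     : ∀ A B → Alpha (F (A ∨′ B)) (F A) (F B)
  tNotImp : ∀ A B → Alpha (T (¬′ (A ⇒′ B))) (T A) (T (¬′ B))
  fImp    : ∀ A B → Alpha (F (A ⇒′ B)) (F (¬′ A)) (F B)
  tNotNot : ∀ A → Alpha (T (¬′ (¬′ A))) (T A) (T A)
  fNotNot : ∀ A → Alpha (F (¬′ (¬′ A))) (F A) (F A)

data Beta : Signed → Signed → Signed → Set where
  tOr     : ∀ A B → Beta (T (A ∨′ B)) (T A) (T B)
  fNotOr  : ∀ A B → Beta (F (¬′ (A ∨′ B))) (F (¬′ A)) (F (¬′ B))
  tNotAnd : ∀ A B → Beta (T (¬′ (A ∧′ B))) (T (¬′ A)) (T (¬′ B))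
  fAnd    : ∀ A B → Beta (F (A ∧′ B)) (F A) (F B)
  tImp    : ∀ A B → Beta (T (A ⇒′ B)) (T (¬′ A)) (T B)
  fNotImp : ∀ A B → Beta (F (¬′ (A ⇒′ B))) (F A) (F (¬′ B))

-- Tableau nodes: signed formula, marking flag, annotation A_u (a finite set,
-- represented as a list; only membership matters)
record Node : Set where
  constructor node
  field
    sf     : Signed
    marked : Bool
    ann    : List Formula
open Node public

-- A branch is the list of its nodes, most recently added node FIRST
-- (so the head of the list is the current last node u).
Branch = List Node

lastAnn : Branch → List Formula
lastAnn [] = []
lastAnn (u ∷ _) = ann u

remove : Formula → List Formula → List Formula
remove χ [] = []
remove χ (x ∷ xs) = if x == χ then remove χ xs else x ∷ remove χ xs

newAnn : Signed → List Formula → List Formula → List Formula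
newAnn (T χ) chis Au = remove χ (chis ++ Au)
newAnn (F χ) chis Au = Au

formulaOf : Signed → Formula
formulaOf (T a) = a
formulaOf (F a) = a

data Mark : Branch → Node → Branch → Set where
  here  : ∀ {s a B} → Mark (node s false a ∷ B) (node s false a) (node s true a ∷ B)
  there : ∀ {m n B B'} → Mark B n B' → Mark (m ∷ B) n (m ∷ B')

initial : List Formula → List Formula → Branch
initial Γ Δ = map (λ d → node (F d) false Γ) Δ ++ map (λ g → node (T g) false Γ) Γ

-- OTABBranch Γ Δ B : B is a branch of some OTAB tableau for Γ ⊢_M Δ
-- (a branch is obtained from the initial branch by a sequence of rule
-- applications (A)/(B) along it; for (B) either successor branch may be kept).
data OTABBranch (Γ Δ : List Formula) : Branch → Set where
  init  : OTABBranch Γ Δ (initial Γ Δ)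
  ruleA : ∀ {B B' s a s₁ s₂} → OTABBranch Γ Δ B →
          Mark B (node s false a) B' → Alpha s s₁ s₂ →
          OTABBranch Γ Δ
            (node s₂ false (newAnn s (formulaOf s₁ ∷ formulaOf s₂ ∷ []) (lastAnn B))
             ∷ node s₁ false (newAnn s (formulaOf s₁ ∷ formulaOf s₂ ∷ []) (lastAnn B))
             ∷ B')
  ruleB₁ : ∀ {B B' s a s₁ s₂} → OTABBranch Γ Δ B →
          Mark B (node s false a) B' → Beta s s₁ s₂ →
          OTABBranch Γ Δ (node s₁ false (newAnn s (formulaOf s₁ ∷ []) (lastAnn B)) ∷ B')
  ruleB₂ : ∀ {B B' s a s₁ s₂} → OTABBranch Γ Δ B →
          Mark B (node s false a) B' → Beta s s₁ s₂ →
          OTABBranch Γ Δ (node s₂ false (newAnn s (formulaOf s₂ ∷ []) (lastAnn B)) ∷ B')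

Completed : Branch → Set
Completed B = All (λ n → marked n ≡ false → Literal (sf n)) B

Contains : Branch → Signed → Set
Contains B s = Any (λ n → sf n ≡ s) B

TClosed : Branch → Set
TClosed B = Σ Formula (λ A → Contains B (T A) × Contains B (T (¬′ A)))

hasTAtom : Branch → ℕ → Bool
hasTAtom [] p = false
hasTAtom (node (T (atom q)) _ _ ∷ B) p = (q ==ℕ p) ∨ hasTAtom B p
hasTAtom (_ ∷ B) p = hasTAtom B p

At : Branch → (ℕ → Bool)
At B = hasTAtom B

module Submission where

-- Two invariants hold along every OTAB branch: each marked node has been
-- expanded (both α-components, or one β-component, occur on the branch), and
-- each annotation A_u consists of formulas asserted (signed T) on the branch.
-- The first is preserved because marking keeps labels and new components are
-- appended; the second because A_v only trades χ for the components T χᵢ just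
-- added (F-rules leave A_u unchanged). On a completed branch every node is a
-- literal or expanded, so the usual Hintikka argument, by induction on χ, shows
-- that At(B) makes every asserted T χ true and every asserted T ¬χ false;
-- the base case T ¬p is where the branch not being T-closed is used.

open import Defs
open import Data.Bool using (Bool; true; false)
open import Data.Bool.Properties using (∨-zeroʳ; ∧-zeroʳ; T-≡)
open import Data.Empty using (⊥; ⊥-elim)
open import Data.List using (List; []; _∷_; _++_; map)
open import Data.List.Membership.Propositional using (_∈_)
open import Data.List.Relation.Unary.All as All using (All; []; _∷_)
open import Data.List.Relation.Unary.All.Properties using (++⁺; map⁺)
open import Data.List.Relation.Unary.Any as Any using (here; there)
open import Data.List.Relation.Unary.Any.Properties using (++⁺ʳ) renaming (map⁺ to Any-map⁺)
open import Data.Nat using (_≡ᵇ_)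
open import Data.Nat.Properties using (≡ᵇ⇒≡; ≡⇒≡ᵇ)
open import Data.Product using (∃₂; _×_; _,_; proj₁; proj₂)
open import Data.Sum using (_⊎_; inj₁; inj₂)
open import Function using (Equivalence; _∘_)
open import Relation.Nullary using (¬_)
open import Relation.Binary.PropositionalEquality using (_≡_; _≢_; refl; subst)

open Equivalence using (to; from)

Asserts : Branch → Formula → Set
Asserts B φ = Contains B (T φ)

Expanded : Branch → Signed → Set
Expanded B s = (∃₂ λ s₁ s₂ → Alpha s s₁ s₂ × Contains B s₁ × Contains B s₂)
             ⊎ (∃₂ λ s₁ s₂ → Beta s s₁ s₂ × (Contains B s₁ ⊎ Contains B s₂))

MarkedExpanded : Branch → Set
MarkedExpanded B = All (λ n → marked n ≡ true → Expanded B (sf n)) B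

AnnotationsAsserted : Branch → Set
AnnotationsAsserted B = All (λ n → All (Asserts B) (ann n)) B

record Invariant (B : Branch) : Set where
  field
    marked-expanded      : MarkedExpanded B
    annotations-asserted : AnnotationsAsserted B
open Invariant

Expanded-mono : ∀ {B B' s} → (∀ {t} → Contains B t → Contains B' t) →
                Expanded B s → Expanded B' s
Expanded-mono f (inj₁ (s₁ , s₂ , α , c₁ , c₂))  = inj₁ (s₁ , s₂ , α , f c₁ , f c₂)
Expanded-mono f (inj₂ (s₁ , s₂ , β , inj₁ c₁)) = inj₂ (s₁ , s₂ , β , inj₁ (f c₁))
Expanded-mono f (inj₂ (s₁ , s₂ , β , inj₂ c₂)) = inj₂ (s₁ , s₂ , β , inj₂ (f c₂))

Mark-Contains : ∀ {B n B' s} → Mark B n B' → Contains B s → Contains B' s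
Mark-Contains here      (here e)  = here e
Mark-Contains here      (there c) = there c
Mark-Contains (there m) (here e)  = here e
Mark-Contains (there m) (there c) = there (Mark-Contains m c)

Mark-All : ∀ {P Q : Node → Set} {B B' s a} → Mark B (node s false a) B' →
           (∀ {n} → P n → Q n) → (P (node s false a) → Q (node s true a)) →
           All P B → All Q B'
Mark-All here      f g (p ∷ ps) = g p ∷ All.map f ps
Mark-All (there m) f g (p ∷ ps) = f p ∷ Mark-All m f g ps

Contains-extend : ∀ {B n B' s} (new : Branch) → Mark B n B' → Contains B s →
                  Contains (new ++ B') s
Contains-extend new m c = ++⁺ʳ new (Mark-Contains m c)

All-remove : ∀ {P : Formula → Set} χ {xs} → All P xs → All P (remove χ xs)
All-remove χ [] = []
All-remove χ {x ∷ _} (p ∷ ps) with x == χ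
... | true  = All-remove χ ps
... | false = p ∷ All-remove χ ps

lastAnn-asserted : ∀ B → AnnotationsAsserted B → All (Asserts B) (lastAnn B)
lastAnn-asserted []      []      = []
lastAnn-asserted (_ ∷ _) (a ∷ _) = a

data TSigned : Signed → Set where
  t-signed : ∀ {a} → TSigned (T a)

α-preserves-TSigned : ∀ {s s₁ s₂} → TSigned s → Alpha s s₁ s₂ → TSigned s₁ × TSigned s₂
α-preserves-TSigned t-signed (tAnd _ _)    = t-signed , t-signed
α-preserves-TSigned t-signed (tNotOr _ _)  = t-signed , t-signed
α-preserves-TSigned t-signed (tNotImp _ _) = t-signed , t-signed
α-preserves-TSigned t-signed (tNotNot _)   = t-signed , t-signed

β-preserves-TSigned : ∀ {s s₁ s₂} → TSigned s → Beta s s₁ s₂ → TSigned s₁ × TSigned s₂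
β-preserves-TSigned t-signed (tOr _ _)     = t-signed , t-signed
β-preserves-TSigned t-signed (tNotAnd _ _) = t-signed , t-signed
β-preserves-TSigned t-signed (tImp _ _)    = t-signed , t-signed

TSigned-asserts : ∀ {B s} → TSigned s → Contains B s → Asserts B (formulaOf s)
TSigned-asserts t-signed c = c

newAnn-asserted : ∀ {X} s {cs Au} → (TSigned s → All TSigned cs) →
                  All (Contains X) cs → All (Asserts X) Au →
                  All (Asserts X) (newAnn s (map formulaOf cs) Au)
newAnn-asserted {X} (T χ) {cs} components-T on-branch Au =
  All-remove χ (++⁺ (map⁺ components-asserted) Au)
  where
    components-asserted : All (Asserts X ∘ formulaOf) cs
    components-asserted = All.zipWith (λ (t , c) → TSigned-asserts t c) (components-T t-signed , on-branch)
newAnn-asserted (F χ) _ _ Au = Au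

initial-unmarked : ∀ Γ Δ → All (λ n → marked n ≡ false × ann n ≡ Γ) (initial Γ Δ)
initial-unmarked Γ Δ =
  ++⁺ (map⁺ (All.universal (λ _ → refl , refl) Δ)) (map⁺ (All.universal (λ _ → refl , refl) Γ))

initial-asserts-Γ : ∀ Γ Δ → All (Asserts (initial Γ Δ)) Γ
initial-asserts-Γ Γ Δ =
  All.tabulate λ γ∈Γ → ++⁺ʳ (map _ Δ) (Any-map⁺ (Any.map (λ { refl → refl }) γ∈Γ))

≡false⇒≢true : ∀ {b : Bool} → b ≡ false → b ≢ true
≡false⇒≢true refl ()

initial-invariant : ∀ Γ Δ → Invariant (initial Γ Δ)
initial-invariant Γ Δ = record
  { marked-expanded      = All.map (λ (u , _) m → ⊥-elim (≡false⇒≢true u m)) (initial-unmarked Γ Δ)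
  ; annotations-asserted = All.map (λ { (_ , refl) → initial-asserts-Γ Γ Δ }) (initial-unmarked Γ Δ)
  }

Invariant-extend : ∀ {B B' s a} → Invariant B → Mark B (node s false a) B' → (new : Branch) →
                   All (λ n → marked n ≡ false) new → Expanded (new ++ B') s →
                   All (λ n → All (Asserts (new ++ B')) (ann n)) new →
                   Invariant (new ++ B')
Invariant-extend {B} {B'} I m new unmarked expanded asserted = record
  { marked-expanded      = ++⁺ (All.map (λ u m → ⊥-elim (≡false⇒≢true u m)) unmarked)
                               (Mark-All m (λ e → Expanded-mono weaken ∘ e) (λ _ _ → expanded)
                                         (marked-expanded I))
  ; annotations-asserted = ++⁺ asserted
                               (Mark-All m (All.map weaken) (All.map weaken) (annotations-asserted I))
  }
  where
    weaken : ∀ {t} → Contains B t → Contains (new ++ B') t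
    weaken = Contains-extend new m

lastAnn-inherited : ∀ {B n B'} (new : Branch) → Mark B n B' → Invariant B →
                    All (Asserts (new ++ B')) (lastAnn B)
lastAnn-inherited {B} new m I =
  All.map (Contains-extend new m) (lastAnn-asserted B (annotations-asserted I))

invariant : ∀ {Γ Δ B} → OTABBranch Γ Δ B → Invariant B
invariant {Γ} {Δ} init = initial-invariant Γ Δ
invariant (ruleA {B = B} {s = s} d m α) =
  Invariant-extend I m new (refl ∷ refl ∷ [])
    (inj₁ (_ , _ , α , there (here refl) , here refl)) (annotation ∷ annotation ∷ [])
  where
    I : Invariant B
    I = invariant d
    new = _ ∷ _ ∷ []
    annotation = newAnn-asserted s (λ p → let p₁ , p₂ = α-preserves-TSigned p α in p₁ ∷ p₂ ∷ [])
                   (there (here refl) ∷ here refl ∷ []) (lastAnn-inherited new m I)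
invariant (ruleB₁ {B = B} {s = s} d m β) =
  Invariant-extend I m new (refl ∷ []) (inj₂ (_ , _ , β , inj₁ (here refl))) (annotation ∷ [])
  where
    I : Invariant B
    I = invariant d
    new = _ ∷ []
    annotation = newAnn-asserted s (λ p → proj₁ (β-preserves-TSigned p β) ∷ []) (here refl ∷ [])
                   (lastAnn-inherited new m I)
invariant (ruleB₂ {B = B} {s = s} d m β) =
  Invariant-extend I m new (refl ∷ []) (inj₂ (_ , _ , β , inj₂ (here refl))) (annotation ∷ [])
  where
    I : Invariant B
    I = invariant d
    new = _ ∷ []
    annotation = newAnn-asserted s (λ p → proj₂ (β-preserves-TSigned p β) ∷ []) (here refl ∷ [])
                   (lastAnn-inherited new m I)

At-sound : ∀ B {p} → Asserts B (atom p) → At B p ≡ true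
At-sound (node (T (atom q)) _ _ ∷ B) (here refl) rewrite T-≡ .to (≡⇒≡ᵇ q q refl) = refl
At-sound (node (T (atom q)) _ _ ∷ B) (there c) rewrite At-sound B c = ∨-zeroʳ _
At-sound (node (T (¬′ _)) _ _ ∷ B)   (there c) = At-sound B c
At-sound (node (T (_ ∧′ _)) _ _ ∷ B) (there c) = At-sound B c
At-sound (node (T (_ ∨′ _)) _ _ ∷ B) (there c) = At-sound B c
At-sound (node (T (_ ⇒′ _)) _ _ ∷ B) (there c) = At-sound B c
At-sound (node (F _) _ _ ∷ B)        (there c) = At-sound B c

At-complete : ∀ B p → At B p ≡ true → Asserts B (atom p)
At-complete (node (T (atom q)) _ _ ∷ B) p e with q ≡ᵇ p in q≡p
... | true rewrite ≡ᵇ⇒≡ q p (T-≡ .from q≡p) = here refl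
... | false = there (At-complete B p e)
At-complete (node (T (¬′ _)) _ _ ∷ B)   p e = there (At-complete B p e)
At-complete (node (T (_ ∧′ _)) _ _ ∷ B) p e = there (At-complete B p e)
At-complete (node (T (_ ∨′ _)) _ _ ∷ B) p e = there (At-complete B p e)
At-complete (node (T (_ ⇒′ _)) _ _ ∷ B) p e = there (At-complete B p e)
At-complete (node (F _) _ _ ∷ B)        p e = there (At-complete B p e)

literal-or-expanded : ∀ {B s} → Completed B → MarkedExpanded B → Contains B s →
                      Literal s ⊎ Expanded B s
literal-or-expanded C E c with All.lookupAny (All.zip (C , E)) c
... | (literal , expanded) , sf≡s with marked (Any.lookup c)
...   | false = inj₁ (subst Literal sf≡s (literal refl))
...   | true  = inj₂ (subst (Expanded _) sf≡s (expanded refl))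

module Hintikka (B : Branch) (completed : Completed B) (expanded : MarkedExpanded B)
                (open-branch : ¬ TClosed B) where

  asserted-true : ∀ χ → Asserts B χ → eval (At B) χ ≡ true
  denied-false  : ∀ χ → Asserts B (¬′ χ) → eval (At B) χ ≡ false

  asserted-true (atom p) c = At-sound B c
  asserted-true (¬′ a) c rewrite denied-false a c = refl
  asserted-true (a ∧′ b) c with literal-or-expanded completed expanded c
  ... | inj₁ ()
  ... | inj₂ (inj₁ (_ , _ , tAnd _ _ , c₁ , c₂)) rewrite asserted-true a c₁ | asserted-true b c₂ = refl
  ... | inj₂ (inj₂ (_ , _ , () , _))
  asserted-true (a ∨′ b) c with literal-or-expanded completed expanded c
  ... | inj₁ ()
  ... | inj₂ (inj₁ (_ , _ , () , _))
  ... | inj₂ (inj₂ (_ , _ , tOr _ _ , inj₁ c₁)) rewrite asserted-true a c₁ = refl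
  ... | inj₂ (inj₂ (_ , _ , tOr _ _ , inj₂ c₂)) rewrite asserted-true b c₂ = ∨-zeroʳ _
  asserted-true (a ⇒′ b) c with literal-or-expanded completed expanded c
  ... | inj₁ ()
  ... | inj₂ (inj₁ (_ , _ , () , _))
  ... | inj₂ (inj₂ (_ , _ , tImp _ _ , inj₁ c₁)) rewrite denied-false a c₁ = refl
  ... | inj₂ (inj₂ (_ , _ , tImp _ _ , inj₂ c₂)) rewrite asserted-true b c₂ = ∨-zeroʳ _

  denied-false (atom p) c with At B p in p∈At
  ... | false = refl
  ... | true  = ⊥-elim (open-branch (atom p , At-complete B p p∈At , c))
  denied-false (¬′ a) c with literal-or-expanded completed expanded c
  ... | inj₁ ()
  ... | inj₂ (inj₁ (_ , _ , tNotNot _ , c₁ , _)) rewrite asserted-true a c₁ = refl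
  ... | inj₂ (inj₂ (_ , _ , () , _))
  denied-false (a ∧′ b) c with literal-or-expanded completed expanded c
  ... | inj₁ ()
  ... | inj₂ (inj₁ (_ , _ , () , _))
  ... | inj₂ (inj₂ (_ , _ , tNotAnd _ _ , inj₁ c₁)) rewrite denied-false a c₁ = refl
  ... | inj₂ (inj₂ (_ , _ , tNotAnd _ _ , inj₂ c₂)) rewrite denied-false b c₂ = ∧-zeroʳ _
  denied-false (a ∨′ b) c with literal-or-expanded completed expanded c
  ... | inj₁ ()
  ... | inj₂ (inj₁ (_ , _ , tNotOr _ _ , c₁ , c₂)) rewrite denied-false a c₁ | denied-false b c₂ = refl
  ... | inj₂ (inj₂ (_ , _ , () , _))
  denied-false (a ⇒′ b) c with literal-or-expanded completed expanded c
  ... | inj₁ ()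
  ... | inj₂ (inj₁ (_ , _ , tNotImp _ _ , c₁ , c₂)) rewrite asserted-true a c₁ | denied-false b c₂ = refl
  ... | inj₂ (inj₂ (_ , _ , () , _))

lemma6 : (Γ Δ : List Formula) (B : Branch) → OTABBranch Γ Δ B →
         Completed B → ¬ TClosed B →
         (u : Node) → u ∈ B → (φ : Formula) → φ ∈ ann u →
         eval (At B) φ ≡ true
lemma6 Γ Δ B tableau completed open-branch u u∈B φ φ∈Aᵤ =
  asserted-true φ (All.lookup (All.lookup (annotations-asserted I) u∈B) φ∈Aᵤ)
  where
    I : Invariant B
    I = invariant tableau
    open Hintikka B completed (marked-expanded I) open-branch
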